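{- Let $1\le k\le n$ and let $S_1,S_2\in\mathcal{H}'_{n,k}$ with $(3\gamma k,(\gamma+1)k)$-bases $S_1'$ and $S_2'$, respectively. If, for some $m\in\mathbb{Z}$, $\mathsf{Ham}(S_1,\mathsf{cyc}^m(S_2))\le k$, then $S_1'=\mathsf{cyc}^m(S_2')$.
   Context: $\mathsf{Ham}(S,T)$ is the number of positions where $S,T\in\Sigma^n$ differ; $\mathsf{cyc}(S)=S[2]\cdots S[n]S[1]$ and $\mathsf{cyc}^m$ its $m$-fold iterate. $\mathsf{root}(S)$ is the length of the shortest $Q$ with $S=Q^a$, $a\ge1$ integer. $S$ is $(\alpha,\beta)$-pseudo-periodic if there is $S'\in\Sigma^n$ (an $(\alpha,\beta)$-base of $S$) with $\mathsf{root}(S')\le n/\alpha$ and $\mathsf{Ham}(S,S')\le\beta$. $\gamma$ is the smallest real number $\ge14$ such that $\frac{n}{3\gamma k}$ is an integer, and $\mathcal{H}'_{n,k}$ is the set of $(3\gamma k,(\gamma+1)k)$-pseudo-periodic strings in $\Sigma^n$. -}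

module Defs where

open import Data.Nat using (ℕ; zero; suc; _+_; _*_; _≤_)
open import Data.Integer using (ℤ; +_; -[1+_])
open import Data.Vec using (Vec; []; _∷_; _∷ʳ_; init; last; toList)
open import Data.List using (List; length; concat; replicate)
open import Data.Product using (Σ; _×_; ∃)
open import Data.Bool using (if_then_else_)
open import Relation.Nullary using (does)
open import Relation.Binary.Definitions using (DecidableEquality)
open import Relation.Binary.PropositionalEquality using (_≡_)

Ham : {A : Set} → DecidableEquality A → {n : ℕ} → Vec A n → Vec A n → ℕ
Ham _≟_ [] [] = 0
Ham _≟_ (x ∷ xs) (y ∷ ys) = (if does (x ≟ y) then 0 else 1) + Ham _≟_ xs ys

cyc : {A : Set} {n : ℕ} → Vec A n → Vec A n
cyc [] = []
cyc (x ∷ xs) = xs ∷ʳ x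

cycInv : {A : Set} {n : ℕ} → Vec A n → Vec A n
cycInv [] = []
cycInv (x ∷ xs) = last (x ∷ xs) ∷ init (x ∷ xs)

iter : {X : Set} → ℕ → (X → X) → X → X
iter zero f x = x
iter (suc m) f x = f (iter m f x)

cycPow : {A : Set} {n : ℕ} → ℤ → Vec A n → Vec A n
cycPow (+ m) S = iter m cyc S
cycPow -[1+ m ] S = iter (suc m) cycInv S

pow : {A : Set} → List A → ℕ → List A
pow Q a = concat (replicate a Q)

IsRoot : {A : Set} → List A → ℕ → Set
IsRoot {A} S r =
  (Σ (List A) λ Q → Σ ℕ λ a → 1 ≤ a × S ≡ pow Q a × length Q ≡ r)
  × ((Q : List A) (a : ℕ) → 1 ≤ a → S ≡ pow Q a → r ≤ length Q)

-- γ is the smallest real ≥ 14 with n/(3γk) an integer.  Writing j = n/(3γk)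
-- (a positive integer), γ = n/(3kj), and γ ≥ 14 ⇔ 42kj ≤ n; smallest γ ⇔ largest j.
-- IsGammaIndex n k j : j = n/(3γk).
IsGammaIndex : ℕ → ℕ → ℕ → Set
IsGammaIndex n k j = 1 ≤ j × 42 * k * j ≤ n × ((j' : ℕ) → 1 ≤ j' → 42 * k * j' ≤ n → j' ≤ j)

-- S' is a (3γk, (γ+1)k)-base of S, where j = n/(3γk):
--   root(S') ≤ n/(3γk) = j   and   Ham(S,S') ≤ (γ+1)k = n/(3j) + k  (⇔ 3j·Ham ≤ n + 3jk)
IsBase : {A : Set} → DecidableEquality A → {n : ℕ} → (k j : ℕ) → Vec A n → Vec A n → Set
IsBase _≟_ {n} k j S S' =
  (∃ λ r → IsRoot (toList S') r × r ≤ j)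
  × 3 * j * Ham _≟_ S S' ≤ n + 3 * j * k

module Submission where

-- By the triangle inequality and rotation invariance of Ham, the bases S₁' and cyc^m(S₂') are at
-- distance h ≤ h₁ + k + h₂, where 3j·hᵢ ≤ n + 3jk; hence 3jh ≤ 2n + 9jk < 3n, i.e. h < n/j.
-- On the other hand, two distinct words of length n that are powers of words of lengths p, q ≤ j
-- differ in at least n/j positions.  Take a mismatch i₀.  If every position ≡ i₀ (mod p) is a
-- mismatch, that residue class already has n/p elements.  Otherwise some s ≡ i₀ (mod p) is a
-- match; the shift i ↦ i + d with d ≡ s − i₀ (mod n) fixes the first word and carries the class
-- of i₀ mod q onto the class of s mod q, which is disjoint from it, and for every i in the class
-- of i₀ at least one of i, i + d is a mismatch.  This gives n/q mismatches.

open import Defs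
open import Data.Bool using (if_then_else_)
open import Data.Integer using (ℤ)
import Data.Integer as Int
open import Data.List using (List; []; _∷_; _++_; [_]; length)
import Data.List as List
open import Data.List.Properties using (++-assoc; ++-identityʳ; length-++; ∷-injective; ∷ʳ-injective)
open import Data.Maybe using (Maybe; just; nothing)
import Data.Maybe.Properties as Maybe
open import Data.Nat.Base
open import Data.Nat.Properties
open import Data.Nat.DivMod
open import Data.Nat.Divisibility using (_∣_; divides; 0∣⇒≡0)
open import Data.Nat.Tactic.RingSolver using (solve-∀)
open import Algebra.Properties.CommutativeSemigroup +-commutativeSemigroup using (interchange)
open import Data.Product using (Σ; ∃-syntax; _×_; _,_; proj₁; proj₂)
open import Data.Sum using (_⊎_; inj₁; inj₂)
open import Data.Vec using (Vec; []; _∷_; _∷ʳ_; toList; init; last; initLast)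
import Data.Vec.Properties as Vec
open import Relation.Nullary using (Dec; yes; no; ¬_; contradiction; does)
open import Relation.Nullary.Decidable using (_×-dec_; dec-true; dec-false; decidable-stable)
open import Relation.Binary.Definitions using (DecidableEquality)
open import Relation.Binary.PropositionalEquality hiding ([_])
open import Function using (case_of_)

sum : ℕ → (ℕ → ℕ) → ℕ
sum zero    f = 0
sum (suc n) f = f 0 + sum n (λ i → f (suc i))

infix 6.5 sum
syntax sum n (λ i → e) = ∑[ i < n ] e

sum-cong : ∀ n {f g : ℕ → ℕ} → (∀ i → i < n → f i ≡ g i) → sum n f ≡ sum n g
sum-cong zero    f≡g = refl
sum-cong (suc n) f≡g = cong₂ _+_ (f≡g 0 z<s) (sum-cong n λ i i<n → f≡g (suc i) (s<s i<n))

sum-mono : ∀ n {f g : ℕ → ℕ} → (∀ i → i < n → f i ≤ g i) → sum n f ≤ sum n g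
sum-mono zero    f≤g = z≤n
sum-mono (suc n) f≤g = +-mono-≤ (f≤g 0 z<s) (sum-mono n λ i i<n → f≤g (suc i) (s<s i<n))

sum-+ : ∀ n (f g : ℕ → ℕ) → ∑[ i < n ] (f i + g i) ≡ sum n f + sum n g
sum-+ zero    f g = refl
sum-+ (suc n) f g =
  trans (cong (f 0 + g 0 +_) (sum-+ n (λ i → f (suc i)) (λ i → g (suc i))))
        (interchange (f 0) (g 0) _ _)

sum-const : ∀ n c → ∑[ i < n ] c ≡ n * c
sum-const zero    c = refl
sum-const (suc n) c = cong (c +_) (sum-const n c)

sum-swap : ∀ n q (h : ℕ → ℕ → ℕ) → ∑[ i < n ] ∑[ t < q ] h i t ≡ ∑[ t < q ] ∑[ i < n ] h i t
sum-swap zero    q h = sym (trans (sum-const q 0) (*-zeroʳ q))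
sum-swap (suc n) q h =
  trans (cong (sum q (h 0) +_) (sum-swap n q (λ i → h (suc i))))
        (sym (sum-+ q (h 0) (λ t → ∑[ i < n ] h (suc i) t)))

sum-snoc : ∀ n (f : ℕ → ℕ) → sum (suc n) f ≡ sum n f + f n
sum-snoc zero    f = +-comm (f 0) 0
sum-snoc (suc n) f = trans (cong (f 0 +_) (sum-snoc n (λ i → f (suc i)))) (sym (+-assoc (f 0) _ _))

sum-shift-periodic : ∀ n (f : ℕ → ℕ) → (∀ i → f (i + n) ≡ f i) →
                     ∀ t → ∑[ i < n ] f (i + t) ≡ sum n f
sum-shift-periodic n f f-periodic zero = sum-cong n λ i _ → cong f (+-identityʳ i)
sum-shift-periodic n f f-periodic (suc t) = begin
  ∑[ i < n ] f (i + suc t)  ≡⟨ sum-cong n (λ i _ → cong f (+-suc i t)) ⟩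
  ∑[ i < n ] g (suc i)      ≡⟨ +-cancelˡ-≡ (g 0) _ _ shift-by-one ⟩
  sum n g                   ≡⟨ sum-shift-periodic n f f-periodic t ⟩
  sum n f                   ∎
  where
  open ≡-Reasoning
  g : ℕ → ℕ
  g i = f (i + t)
  shift-by-one : g 0 + ∑[ i < n ] g (suc i) ≡ g 0 + sum n g
  shift-by-one = begin
    sum (suc n) g  ≡⟨ sum-snoc n g ⟩
    sum n g + g n  ≡⟨ cong (sum n g +_) (trans (cong f (+-comm n t)) (f-periodic t)) ⟩
    sum n g + g 0  ≡⟨ +-comm (sum n g) (g 0) ⟩
    g 0 + sum n g  ∎

term≤sum : ∀ {n t} {f : ℕ → ℕ} → t < n → f t ≤ sum n f
term≤sum {suc n} {zero}  {f} _         = m≤m+n (f 0) _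
term≤sum {suc n} {suc t} {f} (s<s t<n) = ≤-trans (term≤sum t<n) (m≤n+m _ (f 0))

𝟙 : {P : Set} → Dec P → ℕ
𝟙 P? = if does P? then 1 else 0

𝟙-yes : {P : Set} (P? : Dec P) → P → 𝟙 P? ≡ 1
𝟙-yes P? p = cong (if_then 1 else 0) (dec-true P? p)

𝟙≤ : {P : Set} (P? : Dec P) {u : ℕ} → (P → 1 ≤ u) → 𝟙 P? ≤ u
𝟙≤ (yes p) 1≤u = 1≤u p
𝟙≤ (no _)  _   = z≤n

𝟙≤𝟙* : {P : Set} (P? : Dec P) {u : ℕ} → (P → 1 ≤ u) → 𝟙 P? ≤ 𝟙 P? * u
𝟙≤𝟙* (yes p) {u} 1≤u = subst (1 ≤_) (sym (*-identityˡ u)) (1≤u p)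
𝟙≤𝟙* (no _)  _       = z≤n

𝟙+𝟙≤1 : {P Q : Set} (P? : Dec P) (Q? : Dec Q) → (Q → ¬ P) → 𝟙 P? + 𝟙 Q? ≤ 1
𝟙+𝟙≤1 (yes p) (yes q) Q→¬P = contradiction p (Q→¬P q)
𝟙+𝟙≤1 (yes _) (no _)  _    = s≤s z≤n
𝟙+𝟙≤1 (no _)  (yes _) _    = s≤s z≤n
𝟙+𝟙≤1 (no _)  (no _)  _    = z≤n

residue-reachable : ∀ q .{{_ : NonZero q}} c i → ∃[ t ] t < q × (i + t) % q ≡ c % q
residue-reachable q c zero = c % q , m%n<n c q , m%n%n≡m%n c q
residue-reachable q@(suc q′) c (suc i) with residue-reachable q c i
... | suc t , t<q , i+t≡c = t , <⇒≤ t<q , trans (cong (_% q) (sym (+-suc i t))) i+t≡c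
... | zero  , _   , i≡c  = q′ , ≤-refl , (begin
  (suc i + q′) % q ≡⟨ cong (_% q) (sym (+-suc i q′)) ⟩
  (i + q) % q      ≡⟨ [m+n]%n≡m%n i q ⟩
  i % q            ≡⟨ cong (_% q) (sym (+-identityʳ i)) ⟩
  (i + 0) % q      ≡⟨ i≡c ⟩
  c % q            ∎)
  where open ≡-Reasoning

residueClass-count : ∀ {n} q .{{_ : NonZero q}} c → q ∣ n → n ≤ q * (∑[ i < n ] 𝟙 (i % q ≟ c % q))
residueClass-count {n} q c q∣n = begin
  n                                 ≡⟨ sym (trans (sum-const n 1) (*-identityʳ n)) ⟩
  ∑[ i < n ] 1                      ≤⟨ sum-mono n (λ i _ → window-hits i) ⟩
  ∑[ i < n ] ∑[ t < q ] χ (i + t)   ≡⟨ sum-swap n q (λ i t → χ (i + t)) ⟩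
  ∑[ t < q ] ∑[ i < n ] χ (i + t)   ≡⟨ sum-cong q (λ t _ → sum-shift-periodic n χ χ-periodic t) ⟩
  ∑[ t < q ] sum n χ                ≡⟨ sum-const q (sum n χ) ⟩
  q * sum n χ                       ∎
  where
  open ≤-Reasoning
  χ : ℕ → ℕ
  χ i = 𝟙 (i % q ≟ c % q)
  χ-periodic : ∀ i → χ (i + n) ≡ χ i
  χ-periodic i = cong (λ r → 𝟙 (r ≟ c % q)) (%-remove-+ʳ i q∣n)
  window-hits : ∀ i → 1 ≤ ∑[ t < q ] χ (i + t)
  window-hits i with residue-reachable q c i
  ... | t , t<q , i+t≡c = ≤-trans (≤-reflexive (sym (𝟙-yes (_ ≟ c % q) i+t≡c))) (term≤sum t<q)

m%d≡n%d⇒[m+o]%d≡[n+o]%d : ∀ {m n} o d .{{_ : NonZero d}} → m % d ≡ n % d → (m + o) % d ≡ (n + o) % d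
m%d≡n%d⇒[m+o]%d≡[n+o]%d {m} {n} o d m≡n = begin
  (m + o) % d              ≡⟨ %-distribˡ-+ m o d ⟩
  (m % d + o % d) % d      ≡⟨ cong (λ r → (r + o % d) % d) m≡n ⟩
  (n % d + o % d) % d      ≡⟨ %-distribˡ-+ n o d ⟨
  (n + o) % d              ∎
  where open ≡-Reasoning

%-complement-cancel : ∀ {a b c n} d .{{_ : NonZero d}} → d ∣ n → b ≤ n → a % d ≡ b % d →
                      (a + (n ∸ b) + c) % d ≡ c % d
%-complement-cancel {a} {b} {c} {n} d d∣n b≤n a≡b = begin
  (a + (n ∸ b) + c) % d    ≡⟨ cong (_% d) (+-assoc a (n ∸ b) c) ⟩
  (a + (n ∸ b + c)) % d    ≡⟨ m%d≡n%d⇒[m+o]%d≡[n+o]%d (n ∸ b + c) d a≡b ⟩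
  (b + (n ∸ b + c)) % d    ≡⟨ cong (_% d) (trans (sym (+-assoc b (n ∸ b) c)) (cong (_+ c) (m+[n∸m]≡n b≤n))) ⟩
  (n + c) % d              ≡⟨ %-remove-+ˡ c d∣n ⟩
  c % d                    ∎
  where open ≡-Reasoning

m∣n⇒nonZero : ∀ {m n} → m ∣ n → 0 < n → NonZero m
m∣n⇒nonZero m∣n 0<n = ≢-nonZero λ { refl → <⇒≢ 0<n (sym (0∣⇒≡0 m∣n)) }

mismatch : {B : Set} → DecidableEquality B → B → B → ℕ
mismatch _≟ᴮ_ a b = if does (a ≟ᴮ b) then 0 else 1

mismatch-≢ : {B : Set} (_≟ᴮ_ : DecidableEquality B) {a b : B} → a ≢ b → mismatch _≟ᴮ_ a b ≡ 1
mismatch-≢ _≟ᴮ_ {a} {b} a≢b = cong (if_then 0 else 1) (dec-false (a ≟ᴮ b) a≢b)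

module PeriodicMismatch {B : Set} (_≟ᴮ_ : DecidableEquality B) {n p q : ℕ}
  .{{_ : NonZero p}} .{{_ : NonZero q}} (p∣n : p ∣ n) (q∣n : q ∣ n) (X Y : ℕ → B) where

  x y : ℕ → B
  x i = X (i % p)
  y i = Y (i % q)

  δ : ℕ → ℕ
  δ i = mismatch _≟ᴮ_ (x i) (y i)

  δ-periodic : ∀ i → δ (i + n) ≡ δ i
  δ-periodic i = cong₂ (λ r r′ → mismatch _≟ᴮ_ (X r) (Y r′)) (%-remove-+ʳ i p∣n) (%-remove-+ʳ i q∣n)

  mismatched-class⇒n≤p*mismatches : ∀ c → (∀ s → s < n → s % p ≡ c % p → x s ≢ y s) → n ≤ p * sum n δ
  mismatched-class⇒n≤p*mismatches c mismatched =
    ≤-trans (residueClass-count p c p∣n) (*-monoʳ-≤ p (sum-mono n λ s s<n → 𝟙≤ (s % p ≟ c % p) λ s≡c →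
      ≤-reflexive (sym (mismatch-≢ _≟ᴮ_ (mismatched s s<n s≡c)))))

  module Agreement {i₀ s : ℕ} (i₀≤n : i₀ ≤ n) (x≢y : x i₀ ≢ y i₀)
                   (s≡i₀ : s % p ≡ i₀ % p) (agree : x s ≡ y s) where

    d : ℕ
    d = n ∸ i₀ + s

    shift-fixes-mod-p : ∀ i → (i + d) % p ≡ i % p
    shift-fixes-mod-p i = begin
      (i + (n ∸ i₀ + s)) % p   ≡⟨ cong (_% p) (trans (+-comm i _) (cong (_+ i) (+-comm (n ∸ i₀) s))) ⟩
      (s + (n ∸ i₀) + i) % p   ≡⟨ %-complement-cancel p p∣n i₀≤n s≡i₀ ⟩
      i % p                    ∎
      where open ≡-Reasoning

    shift-moves-class : ∀ i → i % q ≡ i₀ % q → (i + d) % q ≡ s % q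
    shift-moves-class i i≡i₀ =
      trans (cong (_% q) (sym (+-assoc i (n ∸ i₀) s))) (%-complement-cancel q q∣n i₀≤n i≡i₀)

    y-s≡x-i₀ : y s ≡ x i₀
    y-s≡x-i₀ = trans (sym agree) (cong X s≡i₀)

    shift-breaks-agreement : ∀ i → i % q ≡ i₀ % q → x i ≡ y i → x (i + d) ≢ y (i + d)
    shift-breaks-agreement i i≡i₀ xi≡yi x≡y = x≢y (begin
      x i₀        ≡⟨ y-s≡x-i₀ ⟨
      y s         ≡⟨ cong Y (shift-moves-class i i≡i₀) ⟨
      y (i + d)   ≡⟨ x≡y ⟨
      x (i + d)   ≡⟨ cong X (shift-fixes-mod-p i) ⟩
      x i         ≡⟨ xi≡yi ⟩
      y i         ≡⟨ cong Y i≡i₀ ⟩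
      y i₀        ∎)
      where open ≡-Reasoning

    shift-leaves-class : ∀ i → i % q ≡ i₀ % q → (i + d) % q ≢ i₀ % q
    shift-leaves-class i i≡i₀ i+d≡i₀ =
      x≢y (trans (sym y-s≡x-i₀) (cong Y (trans (sym (shift-moves-class i i≡i₀)) i+d≡i₀)))

    χ : ℕ → ℕ
    χ i = 𝟙 (i % q ≟ i₀ % q)

    χδ-periodic : ∀ i → χ (i + n) * δ (i + n) ≡ χ i * δ i
    χδ-periodic i = cong₂ _*_ (cong (λ r → 𝟙 (r ≟ i₀ % q)) (%-remove-+ʳ i q∣n)) (δ-periodic i)

    class-covered : ∀ i → χ i ≤ χ i * (δ i + δ (i + d))
    class-covered i = 𝟙≤𝟙* (i % q ≟ i₀ % q) λ i≡i₀ → case x i ≟ᴮ y i of λ where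
      (yes xi≡yi) → ≤-trans (≤-reflexive (sym (mismatch-≢ _≟ᴮ_ (shift-breaks-agreement i i≡i₀ xi≡yi))))
                            (m≤n+m _ (δ i))
      (no  xi≢yi) → ≤-trans (≤-reflexive (sym (mismatch-≢ _≟ᴮ_ xi≢yi))) (m≤m+n _ _)

    classes-disjoint : ∀ i → χ (i + d) + χ i ≤ 1
    classes-disjoint i = 𝟙+𝟙≤1 ((i + d) % q ≟ i₀ % q) (i % q ≟ i₀ % q) (shift-leaves-class i)

    class≤mismatches : sum n χ ≤ sum n δ
    class≤mismatches = begin
      sum n χ                                               ≤⟨ sum-mono n (λ i _ → class-covered i) ⟩
      ∑[ i < n ] χ i * (δ i + δ (i + d))                    ≡⟨ sum-cong n (λ i _ → *-distribˡ-+ (χ i) _ _) ⟩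
      ∑[ i < n ] (χ i * δ i + χ i * δ (i + d))              ≡⟨ sum-+ n _ _ ⟩
      ∑[ i < n ] χ i * δ i + ∑[ i < n ] χ i * δ (i + d)     ≡⟨ cong (_+ ∑[ i < n ] χ i * δ (i + d)) (sum-shift-periodic n _ χδ-periodic d) ⟨
      ∑[ i < n ] χ (i + d) * δ (i + d) + ∑[ i < n ] χ i * δ (i + d)  ≡⟨ sum-+ n _ _ ⟨
      ∑[ i < n ] (χ (i + d) * δ (i + d) + χ i * δ (i + d))  ≡⟨ sum-cong n (λ i _ → *-distribʳ-+ (δ (i + d)) (χ (i + d)) (χ i)) ⟨
      ∑[ i < n ] (χ (i + d) + χ i) * δ (i + d)              ≤⟨ sum-mono n (λ i _ → *-monoˡ-≤ (δ (i + d)) (classes-disjoint i)) ⟩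
      ∑[ i < n ] 1 * δ (i + d)                              ≡⟨ sum-cong n (λ i _ → *-identityˡ (δ (i + d))) ⟩
      ∑[ i < n ] δ (i + d)                                  ≡⟨ sum-shift-periodic n δ δ-periodic d ⟩
      sum n δ                                               ∎
      where open ≤-Reasoning

    n≤q*mismatches : n ≤ q * sum n δ
    n≤q*mismatches = ≤-trans (residueClass-count q i₀ q∣n) (*-monoʳ-≤ q class≤mismatches)

  n≤period*mismatches : ∀ {i₀} → i₀ ≤ n → x i₀ ≢ y i₀ → n ≤ p * sum n δ ⊎ n ≤ q * sum n δ
  n≤period*mismatches {i₀} i₀≤n x≢y
    with anyUpTo? (λ s → (s % p ≟ i₀ % p) ×-dec (x s ≟ᴮ y s)) n
  ... | yes (s , _ , s≡i₀ , agree) = inj₂ (Agreement.n≤q*mismatches i₀≤n x≢y s≡i₀ agree)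
  ... | no  ¬agree = inj₁ (mismatched-class⇒n≤p*mismatches i₀ λ s s<n s≡i₀ x≡y → ¬agree (s , s<n , s≡i₀ , x≡y))

nth : {X : Set} → List X → ℕ → Maybe X
nth []       _       = nothing
nth (x ∷ xs) zero    = just x
nth (x ∷ xs) (suc k) = nth xs k

nth-++ˡ : {X : Set} (P M : List X) {k : ℕ} → k < length P → nth (P ++ M) k ≡ nth P k
nth-++ˡ (x ∷ P) M {zero}  _         = refl
nth-++ˡ (x ∷ P) M {suc k} (s<s k<P) = nth-++ˡ P M k<P

nth-++ʳ : {X : Set} (P M : List X) {k : ℕ} → length P ≤ k → nth (P ++ M) k ≡ nth M (k ∸ length P)
nth-++ʳ []      M         _         = refl
nth-++ʳ (x ∷ P) M {suc k} (s≤s P≤k) = nth-++ʳ P M P≤k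

pow-[] : {X : Set} (a : ℕ) → pow {X} [] a ≡ []
pow-[] zero    = refl
pow-[] (suc a) = pow-[] a

length-pow : {X : Set} (Q : List X) (a : ℕ) → length (pow Q a) ≡ a * length Q
length-pow Q zero    = refl
length-pow Q (suc a) = trans (length-++ Q) (cong (length Q +_) (length-pow Q a))

pow-rotate : {X : Set} (u v : List X) (a : ℕ) → pow (u ++ v) (suc a) ≡ u ++ (pow (v ++ u) a ++ v)
pow-rotate u v zero = ++-identityʳ (u ++ v)
pow-rotate u v (suc a) = begin
  (u ++ v) ++ pow (u ++ v) (suc a)           ≡⟨ cong ((u ++ v) ++_) (pow-rotate u v a) ⟩
  (u ++ v) ++ (u ++ (P ++ v))                ≡⟨ ++-assoc u v _ ⟩
  u ++ (v ++ (u ++ (P ++ v)))                ≡⟨ cong (u ++_) (++-assoc v u _) ⟨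
  u ++ ((v ++ u) ++ (P ++ v))                ≡⟨ cong (u ++_) (++-assoc (v ++ u) P v) ⟨
  u ++ (((v ++ u) ++ P) ++ v)                ∎
  where
  open ≡-Reasoning
  P = pow (v ++ u) a

pow-nth : {X : Set} {p : ℕ} .{{_ : NonZero p}} (Q : List X) → length Q ≡ p →
          ∀ a {k} → k < a * p → nth (pow Q a) k ≡ nth Q (k % p)
pow-nth {p = p} Q refl (suc a) {k} k<ap with k <? p
... | yes k<p = trans (nth-++ˡ Q (pow Q a) k<p) (cong (nth Q) (sym (m<n⇒m%n≡m k<p)))
... | no  k≮p = begin
  nth (Q ++ pow Q a) k   ≡⟨ nth-++ʳ Q (pow Q a) p≤k ⟩
  nth (pow Q a) (k ∸ p)  ≡⟨ pow-nth Q refl a k∸p<ap ⟩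
  nth Q ((k ∸ p) % p)    ≡⟨ cong (nth Q) (m≤n⇒[n∸m]%m≡n%m p≤k) ⟩
  nth Q (k % p)          ∎
  where
  open ≡-Reasoning
  p≤k : p ≤ k
  p≤k = ≮⇒≥ k≮p
  k∸p<ap : k ∸ p < a * p
  k∸p<ap = +-cancelˡ-< p _ _ (subst (_< p + a * p) (sym (m+[n∸m]≡n p≤k)) k<ap)

IsPower : {X : Set} → ℕ → List X → Set
IsPower {X} p S = Σ (List X) λ Q → Σ ℕ λ a → S ≡ pow Q a × length Q ≡ p

IsRoot⇒IsPower : {X : Set} {S : List X} {r : ℕ} → IsRoot S r → IsPower r S
IsRoot⇒IsPower ((Q , a , _ , S≡Qᵃ , |Q|≡r) , _) = Q , a , S≡Qᵃ , |Q|≡r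

module _ {A : Set} {p : ℕ} where

  IsPower-cyc : ∀ {n} (V : Vec A n) → IsPower p (toList V) → IsPower p (toList (cyc V))
  IsPower-cyc []       P = P
  IsPower-cyc (x ∷ xs) (Q , zero , () , _)
  IsPower-cyc (x ∷ xs) ([] , suc a , V≡Qᵃ , _) = contradiction (trans V≡Qᵃ (pow-[] a)) λ ()
  IsPower-cyc (x ∷ xs) (q ∷ Q , suc a , V≡Qᵃ , |Q|≡p) with ∷-injective V≡Qᵃ
  ... | refl , xs≡ = Q ++ [ q ] , suc a , (begin
    toList (xs ∷ʳ x)                ≡⟨ Vec.toList-∷ʳ x xs ⟩
    toList xs ++ [ x ]              ≡⟨ cong (_++ [ x ]) xs≡ ⟩
    (Q ++ pow (q ∷ Q) a) ++ [ x ]   ≡⟨ ++-assoc Q _ _ ⟩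
    Q ++ (pow (q ∷ Q) a ++ [ x ])   ≡⟨ pow-rotate Q [ q ] a ⟨
    pow (Q ++ [ q ]) (suc a)        ∎) , trans (length-++ Q) (trans (+-comm _ 1) |Q|≡p)
    where open ≡-Reasoning

  IsPower-cycInv : ∀ {n} (V : Vec A n) → IsPower p (toList V) → IsPower p (toList (cycInv V))
  IsPower-cycInv []       P = P
  IsPower-cycInv (x ∷ xs) (Q , zero , () , _)
  IsPower-cycInv V@(x ∷ xs) (Q , suc a , V≡Qᵃ , |Q|≡p) with List.initLast Q
  ... | [] = contradiction (trans V≡Qᵃ (pow-[] a)) λ ()
  ... | Q′ List.∷ʳ′ q with ∷ʳ-injective (toList (init V)) _ init∷ʳlast≡
    where
    init∷ʳlast≡ : toList (init V) ++ [ last V ] ≡ (Q′ ++ pow (q ∷ Q′) a) ++ [ q ]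
    init∷ʳlast≡ = begin
      toList (init V) ++ [ last V ]   ≡⟨ Vec.toList-∷ʳ (last V) (init V) ⟨
      toList (init V ∷ʳ last V)       ≡⟨ cong toList (proj₂ (proj₂ (initLast V))) ⟨
      toList V                        ≡⟨ V≡Qᵃ ⟩
      pow (Q′ ++ [ q ]) (suc a)       ≡⟨ pow-rotate Q′ [ q ] a ⟩
      Q′ ++ (pow (q ∷ Q′) a ++ [ q ]) ≡⟨ ++-assoc Q′ _ _ ⟨
      (Q′ ++ pow (q ∷ Q′) a) ++ [ q ] ∎
      where open ≡-Reasoning
  ... | init≡ , last≡ = q ∷ Q′ , suc a , cong₂ _∷_ last≡ init≡ ,
                        trans (sym (trans (length-++ Q′) (+-comm _ 1))) |Q|≡p

  IsPower-iter : ∀ {n} (f : Vec A n → Vec A n) → (∀ V → IsPower p (toList V) → IsPower p (toList (f V))) →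
                 ∀ m V → IsPower p (toList V) → IsPower p (toList (iter m f V))
  IsPower-iter f f-pres zero    V P = P
  IsPower-iter f f-pres (suc m) V P = f-pres _ (IsPower-iter f f-pres m V P)

  IsPower-cycPow : ∀ {n} m (V : Vec A n) → IsPower p (toList V) → IsPower p (toList (cycPow m V))
  IsPower-cycPow (Int.+ m)     = IsPower-iter cyc IsPower-cyc m
  IsPower-cycPow Int.-[1+ m ]  = IsPower-iter cycInv IsPower-cycInv (suc m)

  IsPower-length : ∀ {n} {V : Vec A n} (P : IsPower p (toList V)) → n ≡ proj₁ (proj₂ P) * p
  IsPower-length {V = V} (Q , a , V≡Qᵃ , refl) =
    trans (sym (Vec.length-toList V)) (trans (cong length V≡Qᵃ) (length-pow Q a))

  IsPower⇒∣ : ∀ {n} {V : Vec A n} → IsPower p (toList V) → p ∣ n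
  IsPower⇒∣ P = divides (proj₁ (proj₂ P)) (IsPower-length P)

  IsPower-nth : ∀ {n} {V : Vec A n} .{{_ : NonZero p}} (P : IsPower p (toList V)) →
                ∀ {i} → i < n → nth (toList V) i ≡ nth (proj₁ P) (i % p)
  IsPower-nth P@(Q , a , V≡Qᵃ , |Q|≡p) i<n =
    trans (cong (λ S → nth S _) V≡Qᵃ) (pow-nth Q |Q|≡p a (subst (_ <_) (IsPower-length P) i<n))

module _ {A : Set} (_≟_ : DecidableEquality A) where

  mismatch-sym : ∀ a b → mismatch _≟_ a b ≡ mismatch _≟_ b a
  mismatch-sym a b with a ≟ b | b ≟ a
  ... | yes _   | yes _   = refl
  ... | no  _   | no  _   = refl
  ... | yes a≡b | no  b≢a = contradiction (sym a≡b) b≢a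
  ... | no  a≢b | yes b≡a = contradiction (sym b≡a) a≢b

  mismatch-triangle : ∀ a b c → mismatch _≟_ a c ≤ mismatch _≟_ a b + mismatch _≟_ b c
  mismatch-triangle a b c with a ≟ c | a ≟ b | b ≟ c
  ... | yes _   | _       | _       = z≤n
  ... | no  a≢c | yes a≡b | yes b≡c = contradiction (trans a≡b b≡c) a≢c
  ... | no  _   | no  _   | _       = s≤s z≤n
  ... | no  _   | yes _   | no  _   = s≤s z≤n

  Ham-sym : ∀ {n} (V W : Vec A n) → Ham _≟_ V W ≡ Ham _≟_ W V
  Ham-sym []       []       = refl
  Ham-sym (a ∷ as) (b ∷ bs) = cong₂ _+_ (mismatch-sym a b) (Ham-sym as bs)

  Ham-triangle : ∀ {n} (U V W : Vec A n) → Ham _≟_ U W ≤ Ham _≟_ U V + Ham _≟_ V W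
  Ham-triangle []       []       []       = z≤n
  Ham-triangle (a ∷ as) (b ∷ bs) (c ∷ cs) =
    ≤-trans (+-mono-≤ (mismatch-triangle a b c) (Ham-triangle as bs cs))
            (≤-reflexive (interchange (mismatch _≟_ a b) (mismatch _≟_ b c) _ _))

  Ham-∷ʳ : ∀ {n} (xs ys : Vec A n) x y → Ham _≟_ (xs ∷ʳ x) (ys ∷ʳ y) ≡ Ham _≟_ xs ys + mismatch _≟_ x y
  Ham-∷ʳ []       []       x y = +-comm (mismatch _≟_ x y) 0
  Ham-∷ʳ (a ∷ as) (b ∷ bs) x y =
    trans (cong (mismatch _≟_ a b +_) (Ham-∷ʳ as bs x y)) (sym (+-assoc (mismatch _≟_ a b) _ _))

  Ham-cyc : ∀ {n} (V W : Vec A n) → Ham _≟_ (cyc V) (cyc W) ≡ Ham _≟_ V W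
  Ham-cyc []       []       = refl
  Ham-cyc (x ∷ xs) (y ∷ ys) = trans (Ham-∷ʳ xs ys x y) (+-comm _ (mismatch _≟_ x y))

  Ham-cycInv : ∀ {n} (V W : Vec A n) → Ham _≟_ (cycInv V) (cycInv W) ≡ Ham _≟_ V W
  Ham-cycInv []         []         = refl
  Ham-cycInv V@(_ ∷ _) W@(_ ∷ _) = begin
    mismatch _≟_ (last V) (last W) + Ham _≟_ (init V) (init W)  ≡⟨ +-comm (mismatch _≟_ (last V) (last W)) _ ⟩
    Ham _≟_ (init V) (init W) + mismatch _≟_ (last V) (last W)  ≡⟨ Ham-∷ʳ (init V) (init W) (last V) (last W) ⟨
    Ham _≟_ (init V ∷ʳ last V) (init W ∷ʳ last W)               ≡⟨ cong₂ (Ham _≟_) (proj₂ (proj₂ (initLast V)))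
                                                                                 (proj₂ (proj₂ (initLast W))) ⟨
    Ham _≟_ V W                                                 ∎
    where open ≡-Reasoning

  Ham-iter : ∀ {n} (f : Vec A n → Vec A n) → (∀ V W → Ham _≟_ (f V) (f W) ≡ Ham _≟_ V W) →
             ∀ m V W → Ham _≟_ (iter m f V) (iter m f W) ≡ Ham _≟_ V W
  Ham-iter f f-isometry zero    V W = refl
  Ham-iter f f-isometry (suc m) V W = trans (f-isometry _ _) (Ham-iter f f-isometry m V W)

  Ham-cycPow : ∀ {n} m (V W : Vec A n) → Ham _≟_ (cycPow m V) (cycPow m W) ≡ Ham _≟_ V W
  Ham-cycPow (Int.+ m)    = Ham-iter cyc Ham-cyc m
  Ham-cycPow Int.-[1+ m ] = Ham-iter cycInv Ham-cycInv (suc m)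

  Ham≡∑mismatch : ∀ {n} (V W : Vec A n) →
                  Ham _≟_ V W ≡ ∑[ i < n ] mismatch (Maybe.≡-dec _≟_) (nth (toList V) i) (nth (toList W) i)
  Ham≡∑mismatch []       []       = refl
  Ham≡∑mismatch (x ∷ xs) (y ∷ ys) = cong (mismatch _≟_ x y +_) (Ham≡∑mismatch xs ys)

  ≢⇒nth-≢ : ∀ {n} {V W : Vec A n} → V ≢ W → ∃[ i ] i < n × nth (toList V) i ≢ nth (toList W) i
  ≢⇒nth-≢ {V = []}     {[]}     V≢W = contradiction refl V≢W
  ≢⇒nth-≢ {V = x ∷ xs} {y ∷ ys} V≢W with x ≟ y
  ... | no  x≢y  = 0 , z<s , λ x≡y → x≢y (Maybe.just-injective x≡y)
  ... | yes refl with ≢⇒nth-≢ (λ xs≡ys → V≢W (cong (x ∷_) xs≡ys))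
  ...   | i , i<n , differ = suc i , s<s i<n , differ

  Ham-distinct-powers : ∀ {n p q j} {V W : Vec A n} → IsPower p (toList V) → IsPower q (toList W) →
                        p ≤ j → q ≤ j → V ≢ W → n ≤ j * Ham _≟_ V W
  Ham-distinct-powers {n} {p} {q} {j} {V} {W} PV PW p≤j q≤j V≢W with ≢⇒nth-≢ V≢W
  ... | i₀ , i₀<n , differ = subst (λ h → n ≤ j * h) (sym Ham≡∑δ) n≤j*∑δ
    where
    instance
      p≢0 : NonZero p
      p≢0 = m∣n⇒nonZero (IsPower⇒∣ PV) (≤-<-trans z≤n i₀<n)
      q≢0 : NonZero q
      q≢0 = m∣n⇒nonZero (IsPower⇒∣ PW) (≤-<-trans z≤n i₀<n)
    open PeriodicMismatch (Maybe.≡-dec _≟_) (IsPower⇒∣ PV) (IsPower⇒∣ PW) (nth (proj₁ PV)) (nth (proj₁ PW))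
    Ham≡∑δ : Ham _≟_ V W ≡ sum n δ
    Ham≡∑δ = trans (Ham≡∑mismatch V W) (sum-cong n λ i i<n →
               cong₂ (mismatch (Maybe.≡-dec _≟_)) (IsPower-nth PV i<n) (IsPower-nth PW i<n))
    n≤j*∑δ : n ≤ j * sum n δ
    n≤j*∑δ with n≤period*mismatches (<⇒≤ i₀<n)
                  (subst₂ _≢_ (IsPower-nth PV i₀<n) (IsPower-nth PW i₀<n) differ)
    ... | inj₁ n≤p*∑δ = ≤-trans n≤p*∑δ (*-monoˡ-≤ (sum n δ) p≤j)
    ... | inj₂ n≤q*∑δ = ≤-trans n≤q*∑δ (*-monoˡ-≤ (sum n δ) q≤j)

base-distance-bound : ∀ {n k j H₁ H₂ h} → 1 ≤ k → 1 ≤ j → 42 * k * j ≤ n →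
                      3 * j * H₁ ≤ n + 3 * j * k → 3 * j * H₂ ≤ n + 3 * j * k →
                      h ≤ H₁ + (k + H₂) → j * h < n
base-distance-bound {n} {k} {j} {H₁} {H₂} {h} 1≤k 1≤j 42kj≤n close₁ close₂ h≤H₁+k+H₂ =
  *-cancelˡ-< 3 (j * h) n (begin-strict
    3 * (j * h)                                      ≤⟨ *-monoʳ-≤ 3 (*-monoʳ-≤ j h≤H₁+k+H₂) ⟩
    3 * (j * (H₁ + (k + H₂)))                        ≡⟨ distribute j H₁ k H₂ ⟩
    3 * j * H₁ + (3 * j * k + 3 * j * H₂)            ≤⟨ +-mono-≤ close₁ (+-monoʳ-≤ (3 * j * k) close₂) ⟩
    n + 3 * j * k + (3 * j * k + (n + 3 * j * k))    ≡⟨ collect n j k ⟩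
    2 * n + 9 * (j * k)                              <⟨ +-monoʳ-< (2 * n) 9jk<n ⟩
    2 * n + n                                        ≡⟨ +-comm (2 * n) n ⟩
    3 * n                                            ∎)
  where
  open ≤-Reasoning
  distribute : ∀ j H₁ k H₂ → 3 * (j * (H₁ + (k + H₂))) ≡ 3 * j * H₁ + (3 * j * k + 3 * j * H₂)
  distribute = solve-∀
  collect : ∀ n j k → n + 3 * j * k + (3 * j * k + (n + 3 * j * k)) ≡ 2 * n + 9 * (j * k)
  collect = solve-∀
  reorder : ∀ k j → 42 * k * j ≡ 42 * (j * k)
  reorder = solve-∀
  instance
    jk≢0 : NonZero (j * k)
    jk≢0 = >-nonZero (*-mono-≤ 1≤j 1≤k)
  9jk<n : 9 * (j * k) < n
  9jk<n = <-≤-trans (*-monoˡ-< (j * k) (m<m+n 9 {33} z<s)) (subst (_≤ n) (reorder k j) 42kj≤n)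

corollary25 : {A : Set} (_≟_ : DecidableEquality A) (n k j : ℕ) →
    1 ≤ k → k ≤ n → IsGammaIndex n k j →
    (S₁ S₂ S₁' S₂' : Vec A n) →
    IsBase _≟_ k j S₁ S₁' → IsBase _≟_ k j S₂ S₂' →
    (m : ℤ) → Ham _≟_ S₁ (cycPow m S₂) ≤ k →
    S₁' ≡ cycPow m S₂'
corollary25 _≟_ n k j 1≤k _ (1≤j , 42kj≤n , _) S₁ S₂ S₁' S₂'
            ((r₁ , root₁ , r₁≤j) , close₁) ((r₂ , root₂ , r₂≤j) , close₂) m near =
  decidable-stable (Vec.≡-dec _≟_ S₁' T) λ S₁'≢T →
    <⇒≱ (base-distance-bound 1≤k 1≤j 42kj≤n close₁ close₂ bases-close)
        (Ham-distinct-powers _≟_ (IsRoot⇒IsPower root₁) (IsPower-cycPow m S₂' (IsRoot⇒IsPower root₂))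
                             r₁≤j r₂≤j S₁'≢T)
  where
  T = cycPow m S₂'
  bases-close : Ham _≟_ S₁' T ≤ Ham _≟_ S₁ S₁' + (k + Ham _≟_ S₂ S₂')
  bases-close = begin
    Ham _≟_ S₁' T                                                     ≤⟨ Ham-triangle _≟_ S₁' S₁ T ⟩
    Ham _≟_ S₁' S₁ + Ham _≟_ S₁ T                                     ≤⟨ +-monoʳ-≤ _ (Ham-triangle _≟_ S₁ (cycPow m S₂) T) ⟩
    Ham _≟_ S₁' S₁ + (Ham _≟_ S₁ (cycPow m S₂) + Ham _≟_ (cycPow m S₂) T)
      ≤⟨ +-mono-≤ (≤-reflexive (Ham-sym _≟_ S₁' S₁)) (+-mono-≤ near (≤-reflexive (Ham-cycPow _≟_ m S₂ S₂'))) ⟩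
    Ham _≟_ S₁ S₁' + (k + Ham _≟_ S₂ S₂')                             ∎
    where open ≤-Reasoning
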